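{- Let $\Phi:(S,\cdot)\to(T,\cdot)$ be a semigroup homomorphism such that $\Phi(S)$ is a $J$-set in $T$. If $A\subseteq S$ is a $J$-set in $S$, then $\Phi(A)$ is a $J$-set in $T$.
   Context: For a semigroup $(X,\cdot)$ and a set $Y$, $\mathcal P_f(Y)$ denotes the set of finite nonempty subsets of $Y$. Let $\mathcal T_X={}^{\mathbb N}X$ be the set of sequences in $X$; for $m\in\mathbb N$ let $\mathcal J_m=\{(t(1),\dots,t(m))\in\mathbb N^m: t(1)<\dots<t(m)\}$; for $a\in X^{m+1}$, $t\in\mathcal J_m$ and $f\in\mathcal T_X$ put $x(m,a,t,f)=\bigl(\prod_{j=1}^m a(j)\cdot f(t(j))\bigr)\cdot a(m+1)$ (product in increasing order of $j$). A set $B\subseteq X$ is a $J$-set in $X$ if for each $F\in\mathcal P_f(\mathcal T_X)$ there exist $m\in\mathbb N$, $a\in X^{m+1}$ and $t\in\mathcal J_m$ such that $x(m,a,t,f)\in B$ for every $f\in F$. -}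

module Defs where

open import Level using (Level; _⊔_) renaming (suc to lsuc)
open import Algebra.Bundles using (Semigroup)
open import Data.Nat as ℕ using (ℕ; zero; NonZero)
open import Data.Fin using (Fin; zero; suc; _<_)
open import Data.List.NonEmpty using (List⁺)
open import Data.List.Relation.Unary.All using (All)
open import Data.Product using (Σ; ∃; _×_)

Subset : ∀ {c} → Set c → (ℓ : Level) → Set (c ⊔ lsuc ℓ)
Subset X ℓ = X → Set ℓ

module _ {c ℓ} (S : Semigroup c ℓ) where
  open Semigroup S renaming (Carrier to X)

  -- 𝒯_X : sequences ℕ → X  (ℕ here is {0,1,2,...}, an order-isomorphic copy of the paper's ℕ)
  Seq : Set c
  Seq = ℕ → X

  IsIncreasing : ∀ {m} → (Fin m → ℕ) → Set
  IsIncreasing {m} t = ∀ (i j : Fin m) → i < j → t i ℕ.< t j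

  -- product  ∏_{j=1}^{k} a(j)·f(t(j))  in increasing order, with a(m+1) appended:
  -- x(m,a,t,f) = a(1)·f(t(1))·a(2)·f(t(2))···a(m)·f(t(m))·a(m+1)
  -- xword m a t f  builds  a(1)·f(t(1))···a(m)·f(t(m))·a(m+1)  by recursion on m.
  xword : ∀ m → (Fin (ℕ.suc m) → X) → (Fin m → ℕ) → Seq → X
  xword zero    a t f = a zero
  xword (ℕ.suc m) a t f = (a zero ∙ f (t zero)) ∙ xword m (λ j → a (suc j)) (λ j → t (suc j)) f

  IsJSet : ∀ {p} → Subset X p → Set (c ⊔ p)
  IsJSet B = (F : List⁺ Seq) →
    Σ ℕ λ m → NonZero m × Σ (Fin (ℕ.suc m) → X) λ a → Σ (Fin m → ℕ) λ t →
      IsIncreasing t × All (λ f → B (xword m a t f)) (Data.List.NonEmpty.toList F)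

Image : ∀ {c₁ ℓ₁ c₂ ℓ₂ p} (S : Semigroup c₁ ℓ₁) (T : Semigroup c₂ ℓ₂) →
        (Semigroup.Carrier S → Semigroup.Carrier T) →
        Subset (Semigroup.Carrier S) p → Subset (Semigroup.Carrier T) (c₁ ⊔ ℓ₂ ⊔ p)
Image S T Φ A y = Σ (Semigroup.Carrier S) λ s → A s × Semigroup._≈_ T (Φ s) y

Full : ∀ {c} (X : Set c) → Subset X Level.zero
Full X _ = Data.Unit.⊤
  where import Data.Unit

-- Let F be a finite nonempty set of sequences in T.  Since Φ(S) is a
-- J-set, for every threshold N there is a "block" x(m,a,t,f) with t(1) ≥ N
-- whose value lies in Φ(S) for every f ∈ F.  Choosing the thresholds to lie
-- past the previous block gives blocks B₀, B₁, B₂, … at strictly increasing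
-- positions, and for each f ∈ F a sequence g_f in S with Φ(g_f(k)) = B_k(f).
-- Applying the J-set property of A to the finitely many g_f yields a word
-- b₁·g(u₁)···b_m·g(u_m)·b_{m+1} in A; its image under Φ is the T-word
-- Φ(b₁)·B_{u₁}(f)···Φ(b_m)·B_{u_m}(f)·Φ(b_{m+1}), again of the form x(m',a',t',f).
--
-- To make such substitutions easy, words x(m,a,t,f) are represented by the
-- inductive type Pattern (alternating constants and positions), with
-- evaluation, concatenation and shifting of positions.

module Submission where

open import Defs
open import Level using (_⊔_)
open import Algebra.Bundles using (Semigroup)
open import Algebra.Morphism.Structures using (IsMagmaHomomorphism)
open import Data.Nat using (ℕ; zero; suc; _+_; _≤_; z≤n; s≤s; NonZero; _≤′_; ≤′-refl; ≤′-step)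
open import Data.Nat.Properties using (≤-refl; ≤-trans; +-monoˡ-≤; n≤1+n; ≤⇒≤′)
open import Data.Fin using (Fin; zero; suc)
open import Data.List using (List; []; _∷_)
open import Data.List.NonEmpty using (List⁺; _∷_; toList)
import Data.List.NonEmpty as List⁺
open import Data.List.Relation.Unary.All using (All; []; _∷_)
import Data.List.Relation.Unary.All as All
open import Data.List.Relation.Unary.All.Properties using (map⁻)
open import Data.Product using (Σ; _×_; _,_; proj₁; proj₂)
open import Data.Unit using (⊤; tt)
open import Data.Empty using (⊥)
open import Relation.Binary.PropositionalEquality using (_≡_; refl; sym; cong; subst)
import Relation.Binary.Reasoning.Setoid as SetoidReasoning

All-∀ : ∀ {a p} {A : Set a} {P : ℕ → A → Set p} (xs : List A) →
        (∀ k → All (P k) xs) → All (λ x → ∀ k → P k x) xs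
All-∀ []       h = []
All-∀ (x ∷ xs) h = (λ k → All.head (h k)) ∷ All-∀ xs (λ k → All.tail (h k))

mapWith : ∀ {a b p} {A : Set a} {B : Set b} {P : A → Set p} {xs : List A} →
          (∀ {x} → P x → B) → All P xs → List B
mapWith g []       = []
mapWith g (p ∷ ps) = g p ∷ mapWith g ps

mapWith-All : ∀ {a b p q r} {A : Set a} {B : Set b} {P : A → Set p}
              {Q : B → Set q} {R : A → Set r} {xs : List A}
              (g : ∀ {x} → P x → B) (ps : All P xs) →
              (∀ {x} (p : P x) → Q (g p) → R x) →
              All Q (mapWith g ps) → All R xs
mapWith-All g []       bridge []       = []
mapWith-All g (p ∷ ps) bridge (q ∷ qs) = bridge p q ∷ mapWith-All g ps bridge qs

mapWith⁺ : ∀ {a b p} {A : Set a} {B : Set b} {P : A → Set p} →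
           (∀ {x} → P x → B) → (xs : List⁺ A) → All P (toList xs) → List⁺ B
mapWith⁺ g (x ∷ xs) (p ∷ ps) = g p ∷ mapWith g ps

mapWith⁺-All : ∀ {a b p q r} {A : Set a} {B : Set b} {P : A → Set p}
               {Q : B → Set q} {R : A → Set r}
               (g : ∀ {x} → P x → B) (xs : List⁺ A) (ps : All P (toList xs)) →
               (∀ {x} (p : P x) → Q (g p) → R x) →
               All Q (toList (mapWith⁺ g xs ps)) → All R (toList xs)
mapWith⁺-All g (x ∷ xs) (p ∷ ps) bridge qs = mapWith-All g (p ∷ ps) bridge qs

-- Patterns in a semigroup S: a pattern is a word a₁·f(k₁)·a₂·f(k₂)···a_m·f(k_m)·a_{m+1}
-- with an unspecified sequence f; eval f substitutes a sequence.
module Patterns {c ℓ} (S : Semigroup c ℓ) where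
  open Semigroup S renaming (Carrier to X; refl to ≈-refl; sym to ≈-sym; trans to ≈-trans)

  data Pattern : Set c where
    final : X → Pattern
    step  : X → ℕ → Pattern → Pattern

  eval : Seq S → Pattern → X
  eval f (final a)    = a
  eval f (step a k w) = (a ∙ f k) ∙ eval f w

  Above : ℕ → Pattern → Set
  Above n (final _)    = ⊤
  Above n (step _ k w) = n ≤ k × Above (suc k) w

  after : ℕ → Pattern → ℕ
  after n (final _)    = n
  after n (step _ k w) = after (suc k) w

  -- w uses at least one position (the paper's m ≥ 1)
  Proper : Pattern → Set
  Proper (final _)    = ⊥
  Proper (step _ _ _) = ⊤

  Above-weaken : ∀ {m n} w → m ≤ n → Above n w → Above m w
  Above-weaken (final _)    m≤n _          = tt
  Above-weaken (step _ k w) m≤n (n≤k , ab) = ≤-trans m≤n n≤k , ab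

  ≤-after : ∀ n w → Above n w → n ≤ after n w
  ≤-after n (final _)    _          = ≤-refl
  ≤-after n (step _ k w) (n≤k , ab) = ≤-trans n≤k (≤-trans (n≤1+n k) (≤-after (suc k) w ab))

  fromTuple : ∀ m → (Fin (suc m) → X) → (Fin m → ℕ) → Pattern
  fromTuple zero    a t = final (a zero)
  fromTuple (suc m) a t = step (a zero) (t zero) (fromTuple m (λ j → a (suc j)) (λ j → t (suc j)))

  xword-fromTuple : ∀ m a t f → xword S m a t f ≡ eval f (fromTuple m a t)
  xword-fromTuple zero    a t f = refl
  xword-fromTuple (suc m) a t f = cong ((a zero ∙ f (t zero)) ∙_) (xword-fromTuple m _ _ f)

  Above-fromTuple : ∀ {n} m a t → IsIncreasing S t → (∀ i → n ≤ t i) → Above n (fromTuple m a t)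
  Above-fromTuple zero    a t inc bound = tt
  Above-fromTuple (suc m) a t inc bound =
    bound zero , Above-fromTuple m _ _ (λ i j i<j → inc (suc i) (suc j) (s≤s i<j))
                                       (λ i → inc zero (suc i) (s≤s z≤n))

  Proper-fromTuple : ∀ m a t → NonZero m → Proper (fromTuple m a t)
  Proper-fromTuple (suc m) a t _ = tt

  length : Pattern → ℕ
  length (final _)    = 0
  length (step _ _ w) = suc (length w)

  constants : (w : Pattern) → Fin (suc (length w)) → X
  constants (final a)    _       = a
  constants (step a _ w) zero    = a
  constants (step a _ w) (suc i) = constants w i

  positions : (w : Pattern) → Fin (length w) → ℕ
  positions (step _ k w) zero    = k
  positions (step _ k w) (suc i) = positions w i

  xword-toTuple : ∀ f w → xword S (length w) (constants w) (positions w) f ≡ eval f w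
  xword-toTuple f (final a)    = refl
  xword-toTuple f (step a k w) = cong ((a ∙ f k) ∙_) (xword-toTuple f w)

  positions-increasing : ∀ n w → Above n w → (∀ i → n ≤ positions w i) × IsIncreasing S (positions w)
  positions-increasing n (final _)    _          = (λ ()) , (λ ())
  positions-increasing n (step _ k w) (n≤k , ab) = bound , increasing
    where
      rest = positions-increasing (suc k) w ab
      bound : ∀ i → n ≤ positions (step _ k w) i
      bound zero    = n≤k
      bound (suc i) = ≤-trans n≤k (≤-trans (n≤1+n k) (proj₁ rest i))
      increasing : IsIncreasing S (positions (step _ k w))
      increasing zero    (suc j) _         = proj₁ rest j
      increasing (suc i) (suc j) (s≤s i<j) = proj₂ rest i j i<j

  length-nonzero : ∀ w → Proper w → NonZero (length w)
  length-nonzero (step _ _ w) _ = _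

  JCondition : ∀ {p} → Subset X p → List⁺ (Seq S) → Set (c ⊔ p)
  JCondition B F = Σ ℕ λ m → NonZero m × Σ (Fin (suc m) → X) λ a → Σ (Fin m → ℕ) λ t →
                     IsIncreasing S t × All (λ f → B (xword S m a t f)) (toList F)

  Witness : ∀ {p} → Subset X p → ℕ → List (Seq S) → Set (c ⊔ p)
  Witness B N Fs = Σ Pattern λ w → Proper w × Above N w × All (λ f → B (eval f w)) Fs

  witness→condition : ∀ {p} {B : Subset X p} {N} F → Witness B N (toList F) → JCondition B F
  witness→condition {B = B} F (w , proper , above , inB) =
    length w , length-nonzero w proper , constants w , positions w ,
    proj₂ (positions-increasing _ w above) ,
    All.map (λ {f} → subst B (sym (xword-toTuple f w))) inB

  condition→witness : ∀ {p} {B : Subset X p} F → JCondition B F → Witness B 0 (toList F)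
  condition→witness {B = B} F (m , m≢0 , a , t , inc , inB) =
    fromTuple m a t , Proper-fromTuple m a t m≢0 , Above-fromTuple m a t inc (λ _ → z≤n) ,
    All.map (λ {f} → subst B (xword-fromTuple m a t f)) inB

  shift : ℕ → Pattern → Pattern
  shift d (final a)    = final a
  shift d (step a k w) = step a (k + d) (shift d w)

  eval-shift : ∀ d f w → eval (λ k → f (k + d)) w ≡ eval f (shift d w)
  eval-shift d f (final a)    = refl
  eval-shift d f (step a k w) = cong ((a ∙ f (k + d)) ∙_) (eval-shift d f w)

  Above-shift : ∀ n d w → Above n w → Above (n + d) (shift d w)
  Above-shift n d (final a)    _          = tt
  Above-shift n d (step a k w) (n≤k , ab) = +-monoˡ-≤ d n≤k , Above-shift (suc k) d w ab

  Proper-shift : ∀ d w → Proper w → Proper (shift d w)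
  Proper-shift d (step _ _ _) _ = tt

  -- In a J-set the witnessing positions can be chosen beyond any threshold N:
  -- apply the J-set property to the shifted sequences f(· + N) and shift back.
  witness-beyond : ∀ {p} {B : Subset X p} → IsJSet S B → ∀ N F → Witness B N (toList F)
  witness-beyond {B = B} jB N F = shifted (condition→witness {B = B} F′ (jB F′))
    where
      F′ : List⁺ (Seq S)
      F′ = List⁺.map (λ f k → f (k + N)) F
      shifted : Witness B 0 (toList F′) → Witness B N (toList F)
      shifted (w , proper , above , inB) =
        shift N w , Proper-shift N w proper , Above-shift 0 N w above ,
        All.map (λ {f} → subst B (eval-shift N f w)) (map⁻ inB)

  prefix : X → Pattern → Pattern
  prefix c (final a)    = final (c ∙ a)
  prefix c (step a k w) = step (c ∙ a) k w

  _⊕_ : Pattern → Pattern → Pattern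
  final a    ⊕ w₂ = prefix a w₂
  step a k w ⊕ w₂ = step a k (w ⊕ w₂)

  eval-prefix : ∀ f c w → eval f (prefix c w) ≈ c ∙ eval f w
  eval-prefix f c (final a)    = ≈-refl
  eval-prefix f c (step a k w) = begin
      ((c ∙ a) ∙ f k) ∙ eval f w  ≈⟨ assoc (c ∙ a) (f k) (eval f w) ⟩
      (c ∙ a) ∙ (f k ∙ eval f w)  ≈⟨ assoc c a _ ⟩
      c ∙ (a ∙ (f k ∙ eval f w))  ≈⟨ ∙-congˡ (≈-sym (assoc a (f k) (eval f w))) ⟩
      c ∙ ((a ∙ f k) ∙ eval f w)  ∎
    where open SetoidReasoning setoid

  eval-⊕ : ∀ f w₁ w₂ → eval f (w₁ ⊕ w₂) ≈ eval f w₁ ∙ eval f w₂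
  eval-⊕ f (final a)    w₂ = eval-prefix f a w₂
  eval-⊕ f (step a k w) w₂ = ≈-trans (∙-congˡ (eval-⊕ f w w₂)) (≈-sym (assoc (a ∙ f k) (eval f w) (eval f w₂)))

  Above-prefix : ∀ n c w → Above n w → Above n (prefix c w)
  Above-prefix n c (final a)    _  = tt
  Above-prefix n c (step a k w) ab = ab

  Above-⊕ : ∀ {n m} w₁ w₂ → n ≤ m → Above m w₁ → Above (after m w₁) w₂ → Above n (w₁ ⊕ w₂)
  Above-⊕ (final a)    w₂ n≤m _          ab₂ = Above-prefix _ a w₂ (Above-weaken w₂ n≤m ab₂)
  Above-⊕ (step a k w) w₂ n≤m (m≤k , ab) ab₂ = ≤-trans n≤m m≤k , Above-⊕ w w₂ ≤-refl ab ab₂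

  Proper-prefix : ∀ c w → Proper w → Proper (prefix c w)
  Proper-prefix c (step _ _ _) _ = tt

  Proper-⊕ : ∀ w₁ w₂ → Proper w₁ → Proper (w₁ ⊕ w₂)
  Proper-⊕ (step _ _ _) w₂ _ = tt

module Blocks {c ℓ p} (T : Semigroup c ℓ) {P : Subset (Semigroup.Carrier T) p}
              (jP : IsJSet T P) (F : List⁺ (Seq T)) where
  open Patterns T

  blocksBeyond : ∀ N → Witness P N (toList F)
  blocksBeyond N = witness-beyond {B = P} jP N F

  blockAt : ℕ → Pattern
  blockAt N = proj₁ (blocksBeyond N)

  bound : ℕ → ℕ
  bound zero    = 0
  bound (suc k) = after (bound k) (blockAt (bound k))

  block : ℕ → Pattern
  block k = blockAt (bound k)

  block-proper : ∀ k → Proper (block k)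
  block-proper k = proj₁ (proj₂ (blocksBeyond (bound k)))

  block-above : ∀ k → Above (bound k) (block k)
  block-above k = proj₁ (proj₂ (proj₂ (blocksBeyond (bound k))))

  block-in : ∀ k → All (λ f → P (eval f (block k))) (toList F)
  block-in k = proj₂ (proj₂ (proj₂ (blocksBeyond (bound k))))

  bound-mono : ∀ {k k′} → k ≤ k′ → bound k ≤ bound k′
  bound-mono k≤k′ = go (≤⇒≤′ k≤k′)
    where
      go : ∀ {k k′} → k ≤′ k′ → bound k ≤ bound k′
      go ≤′-refl            = ≤-refl
      go (≤′-step {k′} k≤k′) = ≤-trans (go k≤k′) (≤-after (bound k′) (block k′) (block-above k′))

module Substitution {c₁ ℓ₁ c₂ ℓ₂} (S : Semigroup c₁ ℓ₁) (T : Semigroup c₂ ℓ₂)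
                    (Φ : Semigroup.Carrier S → Semigroup.Carrier T)
                    (hom : IsMagmaHomomorphism (Semigroup.rawMagma S) (Semigroup.rawMagma T) Φ)
                    (block : ℕ → Patterns.Pattern T) where
  private
    module S = Semigroup S
    module T = Semigroup T
    module PS = Patterns S
  open Patterns T
  open IsMagmaHomomorphism hom using (homo)

  substitute : PS.Pattern → Pattern
  substitute (PS.final b)    = final (Φ b)
  substitute (PS.step b k v) = prefix (Φ b) (block k ⊕ substitute v)

  Proper-substitute : (∀ k → Proper (block k)) → ∀ v → PS.Proper v → Proper (substitute v)
  Proper-substitute proper (PS.step b k v) _ = Proper-prefix (Φ b) _ (Proper-⊕ (block k) _ (proper k))

  eval-substitute : ∀ (f : Seq T) (g : Seq S) → (∀ k → Φ (g k) T.≈ eval f (block k)) →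
                    ∀ v → Φ (PS.eval g v) T.≈ eval f (substitute v)
  eval-substitute f g preimage (PS.final b)    = T.refl
  eval-substitute f g preimage (PS.step b k v) = begin
      Φ ((b S.∙ g k) S.∙ PS.eval g v)                     ≈⟨ homo _ _ ⟩
      Φ (b S.∙ g k) T.∙ Φ (PS.eval g v)                   ≈⟨ T.∙-cong (homo _ _) (eval-substitute f g preimage v) ⟩
      (Φ b T.∙ Φ (g k)) T.∙ eval f (substitute v)         ≈⟨ T.∙-congʳ (T.∙-congˡ (preimage k)) ⟩
      (Φ b T.∙ eval f (block k)) T.∙ eval f (substitute v) ≈⟨ T.assoc _ _ _ ⟩
      Φ b T.∙ (eval f (block k) T.∙ eval f (substitute v)) ≈⟨ T.∙-congˡ (T.sym (eval-⊕ f (block k) (substitute v))) ⟩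
      Φ b T.∙ eval f (block k ⊕ substitute v)             ≈⟨ T.sym (eval-prefix f (Φ b) (block k ⊕ substitute v)) ⟩
      eval f (prefix (Φ b) (block k ⊕ substitute v))      ∎
    where open SetoidReasoning T.setoid

  Above-substitute : (bound : ℕ → ℕ) → (∀ {k k′} → k ≤ k′ → bound k ≤ bound k′) →
                     (∀ k → Above (bound k) (block k)) →
                     (∀ k → after (bound k) (block k) ≤ bound (suc k)) →
                     ∀ k v → PS.Above k v → Above (bound k) (substitute v)
  Above-substitute bound mono above past k (PS.final b)     _           = tt
  Above-substitute bound mono above past k (PS.step b k′ v) (k≤k′ , ab) =
    Above-prefix _ (Φ b) _
      (Above-⊕ (block k′) (substitute v) (mono k≤k′) (above k′)
        (Above-weaken (substitute v) (past k′) (Above-substitute bound mono above past (suc k′) v ab)))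

theorem3p4 : ∀ {c₁ ℓ₁ c₂ ℓ₂ p} (S : Semigroup c₁ ℓ₁) (T : Semigroup c₂ ℓ₂)
    (Φ : Semigroup.Carrier S → Semigroup.Carrier T) →
    IsMagmaHomomorphism (Semigroup.rawMagma S) (Semigroup.rawMagma T) Φ →
    IsJSet T (Image S T Φ (Full (Semigroup.Carrier S))) →
    (A : Subset (Semigroup.Carrier S) p) → IsJSet S A →
    IsJSet T (Image S T Φ A)
theorem3p4 {c₁ = c₁} {ℓ₂ = ℓ₂} S T Φ hom jΦS A jA F = conclude (PS.witness-beyond {B = A} jA 0 G)
  where
    module PS = Patterns S
    module PT = Patterns T
    ΦS : Subset (Semigroup.Carrier T) (c₁ ⊔ ℓ₂)
    ΦS = Image S T Φ (Full (Semigroup.Carrier S))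
    open Blocks T {P = ΦS} jΦS F
    open Substitution S T Φ hom block

    Preimages : Seq T → Set (c₁ ⊔ ℓ₂)
    Preimages f = ∀ k → ΦS (PT.eval f (block k))

    preimages : All Preimages (toList F)
    preimages = All-∀ (toList F) block-in

    preimage : ∀ {f} → Preimages f → Seq S
    preimage h k = proj₁ (h k)

    G : List⁺ (Seq S)
    G = mapWith⁺ preimage F preimages

    image : ∀ v {f} (h : Preimages f) → A (PS.eval (preimage h) v) → Image S T Φ A (PT.eval f (substitute v))
    image v h inA = PS.eval (preimage h) v , inA , eval-substitute _ _ (λ k → proj₂ (proj₂ (h k))) v

    conclude : PS.Witness A 0 (toList G) → PT.JCondition (Image S T Φ A) F
    conclude (v , proper , above , inA) = PT.witness→condition {B = Image S T Φ A} F
      ( substitute v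
      , Proper-substitute block-proper v proper
      , Above-substitute bound bound-mono block-above (λ _ → ≤-refl) 0 v above
      , mapWith⁺-All preimage F preimages (image v) inA )
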